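{- Consider the instance $X$ described in the context and run the k-means++ seeding algorithm on $X$. Let $p$ be the location of the first chosen center. Then $\Pr[p \ne (0,0)] \le 2^{ -k}$.
   Context: Fix an integer $k \ge 2$, a positive integer $m$ such that all multiplicities below are integers (e.g. $4^{2k}$ divides $m$), a real $r > 0$ and a real $\Delta > 0$. For $1 \le i \le k-1$ let $r_i = 2^{i-1} r$ and $m_i = m/4^{i-1}$; let $x_0 = 0$ and $x_i = \Delta (r_1 + \dots + r_i)$. The instance $X$ is the multiset of points in $\mathbb{R}^2$ consisting of groups $G_0, \dots, G_{k-1}$: $G_0$ consists of $12 k 2^k m$ copies of $(0,0)$; for $1 \le i \le k-1$, $G_i$ consists of $4 k m_i$ copies of $(x_i, 0)$ and, for each $0 \le j \le k-1$, $m_i/4^j$ copies of $(x_i, 2^j r_i)$ and $m_i/4^j$ copies of $(x_i, -2^j r_i)$. The k-means++ seeding algorithm chooses its first center uniformly at random among the points of $X$ (counted with multiplicity), and each subsequent center as a point $p \in X$ with probability proportional to $\min_{c \in C} D(p,c)$ ($D$ = squared Euclidean distance, $C$ = centers chosen so far), until $k$ centers are chosen.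
   Formalization: The parameters $r$ and $\Delta$ are positive rationals instead of positive reals, so the points of $X$ have rational coordinates. -}

module Defs where

open import Data.Nat as ℕ using (ℕ; zero; suc; _∸_; _^_)
open import Data.Nat.DivMod using (_/_)
open import Data.Integer using (+_)
open import Data.Rational as ℚ using (ℚ; 0ℚ; _+_; _*_; -_)
open import Data.Rational.Properties using (_≟_)
open import Data.Product using (_×_; _,_)
open import Data.List using (List; []; _∷_; _++_; replicate; concatMap; upTo; length; map)
open import Data.Bool using (Bool; true; false; if_then_else_)
open import Relation.Nullary using (does)
open import Relation.Binary.PropositionalEquality using (_≡_)

Point : Set
Point = ℚ × ℚ

origin : Point
origin = (0ℚ , 0ℚ)

ℕ→ℚ : ℕ → ℚ
ℕ→ℚ n = (+ n) ℚ./ 1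

-- n / 4^e, computed by repeated division by 4 (exact whenever 4^e ∣ n)
div4^ : ℕ → ℕ → ℕ
div4^ n zero    = n
div4^ n (suc e) = div4^ n e / 4

rᵢ : ℚ → ℕ → ℚ
rᵢ r i = ℕ→ℚ (2 ^ (i ∸ 1)) * r

sumR : ℚ → ℕ → ℚ
sumR r zero    = 0ℚ
sumR r (suc i) = sumR r i + rᵢ r (suc i)

xᵢ : ℚ → ℚ → ℕ → ℚ
xᵢ r Δ i = Δ * sumR r i

-- m_i / 4^j = m / 4^(i-1+j)
multᵢⱼ : ℕ → ℕ → ℕ → ℕ
multᵢⱼ m i j = div4^ m ((i ∸ 1) ℕ.+ j)

mᵢ : ℕ → ℕ → ℕ
mᵢ m i = div4^ m (i ∸ 1)

from1 : ℕ → List ℕ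
from1 n = map suc (upTo n)

groupG : ℕ → ℕ → ℚ → ℚ → ℕ → List Point
groupG k m r Δ i =
  replicate (4 ℕ.* k ℕ.* mᵢ m i) (xᵢ r Δ i , 0ℚ)
  ++ concatMap
       (λ j → replicate (multᵢⱼ m i j) (xᵢ r Δ i , ℕ→ℚ (2 ^ j) * rᵢ r i)
              ++ replicate (multᵢⱼ m i j) (xᵢ r Δ i , - (ℕ→ℚ (2 ^ j) * rᵢ r i)))
       (upTo k)

groupG₀ : ℕ → ℕ → List Point
groupG₀ k m = replicate (12 ℕ.* k ℕ.* 2 ^ k ℕ.* m) origin

-- the instance X as a multiset (list with repetitions)
instanceX : ℕ → ℕ → ℚ → ℚ → List Point
instanceX k m r Δ = groupG₀ k m ++ concatMap (groupG k m r Δ) (from1 (k ∸ 1))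

notOrigin : Point → Bool
notOrigin (a , b) with does (a ≟ 0ℚ) | does (b ≟ 0ℚ)
... | true | true = false
... | _    | _    = true

count : (Point → Bool) → List Point → ℕ
count P []       = 0
count P (x ∷ xs) = if P x then suc (count P xs) else count P xs

-- Probability that the first k-means++ center (chosen uniformly at random
-- among the points of X, counted with multiplicity) satisfies P.
firstCenterProb : (Point → Bool) → List Point → ℚ
firstCenterProb P []         = 0ℚ
firstCenterProb P (x ∷ xs)   = (+ count P (x ∷ xs)) ℚ./ length (x ∷ xs)

MultiplicitiesIntegral : ℕ → ℕ → Set
MultiplicitiesIntegral k m =
  ∀ i j → 1 ℕ.≤ i → i ℕ.≤ k ∸ 1 → j ℕ.≤ k ∸ 1 → (4 ^ ((i ∸ 1) ℕ.+ j)) Data.Nat.Divisibility.∣ m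
  where import Data.Nat.Divisibility

twoPowNeg : ℕ → ℚ
twoPowNeg k = ((+ 1) ℚ./ (2 ^ k)) {{Data.Nat.Properties.m^n≢0 2 k}}
  where import Data.Nat.Properties

{-# OPTIONS --safe #-}
-- Every point off the origin lies in one of the groups G₁, …, G_{k-1}. Since
-- m_i/4^j ≤ m_i, the group G_i has at most 4k m_i + 2k m_i = 6k m_i points,
-- and the m_i decrease by a factor 4, so these groups contain at most
-- (4/3)·6k m = 8k m points in total. The origin alone carries
-- 12k 2^k m ≥ 2^k · 8k m points, so a uniformly chosen first center is off
-- the origin with probability at most 2^(-k).
module Submission where

open import Defs
open import Data.Nat using (ℕ; _≤_)
open import Data.Rational using (ℚ; 0ℚ; _<_)
import Data.Rational as ℚ

open import Data.Bool using (true; false)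
open import Data.Product using (_,_)
open import Data.Integer as ℤ using (+_)
import Data.Integer.Properties as ℤ
open import Data.List using (List; []; _∷_; _++_; replicate; concatMap; applyUpTo; upTo; length; map)
open import Data.List.Properties using (length-++; length-replicate; length-applyUpTo; map-applyUpTo)
open import Data.Nat as ℕ using (zero; suc; z≤n; s≤s; _+_; _*_; _^_; NonZero; _≤′_; ≤′-refl; ≤′-step)
open import Data.Nat.DivMod using (_/_; m/n≤m; m/n*n≤m)
open import Data.Nat.ListAction using (sum)
open import Data.Nat.Properties
open import Data.Nat.Solver using (module +-*-Solver)
open import Data.Rational.Properties using (toℚᵘ-cancel-≤; toℚᵘ-fromℚᵘ)
import Data.Rational.Unnormalised as ℚᵘ
import Data.Rational.Unnormalised.Properties as ℚᵘ
open import Function using (_∘_; id)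
open import Relation.Binary.PropositionalEquality using (_≡_; refl; sym; cong; cong₂; subst₂; module ≡-Reasoning)

open +-*-Solver using (solve; _:=_; _:+_; _:*_; con)

*≤*⇒/≤/ : ∀ a b n d .{{_ : NonZero n}} .{{_ : NonZero d}} →
          a * d ≤ b * n → (+ a) ℚ./ n ℚ.≤ (+ b) ℚ./ d
*≤*⇒/≤/ a b (suc n) (suc d) ad≤bn = toℚᵘ-cancel-≤
  (ℚᵘ.≤-respˡ-≃ (ℚᵘ.≃-sym (toℚᵘ-fromℚᵘ (ℚᵘ.mkℚᵘ (+ a) n)))
  (ℚᵘ.≤-respʳ-≃ (ℚᵘ.≃-sym (toℚᵘ-fromℚᵘ (ℚᵘ.mkℚᵘ (+ b) d)))
    (ℚᵘ.*≤* (subst₂ ℤ._≤_ (ℤ.pos-* a (suc d)) (ℤ.pos-* b (suc n)) (ℤ.+≤+ ad≤bn)))))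

count-++ : ∀ P (xs ys : List Point) → count P (xs ++ ys) ≡ count P xs + count P ys
count-++ P []       ys = refl
count-++ P (x ∷ xs) ys with P x
... | true  = cong suc (count-++ P xs ys)
... | false = count-++ P xs ys

count≤length : ∀ P (xs : List Point) → count P xs ≤ length xs
count≤length P []       = z≤n
count≤length P (x ∷ xs) with P x
... | true  = s≤s (count≤length P xs)
... | false = m≤n⇒m≤1+n (count≤length P xs)

count-replicate-false : ∀ P {x} → P x ≡ false → ∀ n → count P (replicate n x) ≡ 0
count-replicate-false P Px≡false zero    = refl
count-replicate-false P Px≡false (suc n) rewrite Px≡false = count-replicate-false P Px≡false n

firstCenterProb-≤-1/ : ∀ P xs d .{{_ : NonZero d}} →
                       count P xs * d ≤ length xs → firstCenterProb P xs ℚ.≤ (+ 1) ℚ./ d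
firstCenterProb-≤-1/ P []       d _ = *≤*⇒/≤/ 0 1 1 d z≤n
firstCenterProb-≤-1/ P (x ∷ xs) d count*d≤length =
  *≤*⇒/≤/ (count P (x ∷ xs)) 1 (length (x ∷ xs)) d
    (≤-trans count*d≤length (≤-reflexive (sym (*-identityˡ _))))

module _ {A : Set} {B : Set} (f : A → List B) where

  length-concatMap-≤-sum : (g : A → ℕ) → (∀ x → length (f x) ≤ g x) →
                           ∀ xs → length (concatMap f xs) ≤ sum (map g xs)
  length-concatMap-≤-sum g bound []       = z≤n
  length-concatMap-≤-sum g bound (x ∷ xs) = begin
    length (f x ++ concatMap f xs)          ≡⟨ length-++ (f x) ⟩
    length (f x) + length (concatMap f xs)  ≤⟨ +-mono-≤ (bound x) (length-concatMap-≤-sum g bound xs) ⟩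
    g x + sum (map g xs)                    ∎
    where open ≤-Reasoning

  length-concatMap-≤-* : ∀ c → (∀ x → length (f x) ≤ c) →
                         ∀ xs → length (concatMap f xs) ≤ length xs * c
  length-concatMap-≤-* c bound []       = z≤n
  length-concatMap-≤-* c bound (x ∷ xs) = begin
    length (f x ++ concatMap f xs)          ≡⟨ length-++ (f x) ⟩
    length (f x) + length (concatMap f xs)  ≤⟨ +-mono-≤ (bound x) (length-concatMap-≤-* c bound xs) ⟩
    c + length xs * c                       ∎
    where open ≤-Reasoning

sum-applyUpTo-geometric : ∀ q (g : ℕ → ℕ) → (∀ i → suc q * g (suc i) ≤ g i) →
                          ∀ n → q * sum (applyUpTo g n) ≤ suc q * g 0
sum-applyUpTo-geometric q g decay zero    = ≤-trans (≤-reflexive (*-zeroʳ q)) z≤n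
sum-applyUpTo-geometric q g decay (suc n) = begin
  q * (g 0 + sum (applyUpTo (g ∘ suc) n))      ≡⟨ *-distribˡ-+ q (g 0) _ ⟩
  q * g 0 + q * sum (applyUpTo (g ∘ suc) n)    ≤⟨ +-monoʳ-≤ (q * g 0) tail≤g₀ ⟩
  q * g 0 + g 0                                ≡⟨ +-comm (q * g 0) (g 0) ⟩
  suc q * g 0                                  ∎
  where
  open ≤-Reasoning
  tail≤g₀ : q * sum (applyUpTo (g ∘ suc) n) ≤ g 0
  tail≤g₀ = ≤-trans (sum-applyUpTo-geometric q (g ∘ suc) (λ i → decay (suc i)) n) (decay 0)

div4^-antitone : ∀ n {e e′} → e ≤′ e′ → div4^ n e′ ≤ div4^ n e
div4^-antitone n ≤′-refl          = ≤-refl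
div4^-antitone n (≤′-step e≤′e′) = ≤-trans (m/n≤m _ 4) (div4^-antitone n e≤′e′)

*-div4^-decay : ∀ c n e → 4 * (c * div4^ n (suc e)) ≤ c * div4^ n e
*-div4^-decay c n e = begin
  4 * (c * (x / 4))  ≡⟨ solve 2 (λ c y → con 4 :* (c :* y) := c :* (y :* con 4)) refl c (x / 4) ⟩
  c * (x / 4 * 4)    ≤⟨ *-monoʳ-≤ c (m/n*n≤m x 4) ⟩
  c * x              ∎
  where
  open ≤-Reasoning
  x = div4^ n e

multᵢⱼ≤mᵢ : ∀ m i j → multᵢⱼ m i j ≤ mᵢ m i
multᵢⱼ≤mᵢ m i j = div4^-antitone m (≤⇒≤′ (m≤m+n (i ℕ.∸ 1) j))

module _ (k m : ℕ) (r Δ : ℚ) where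

  length-groupG : ∀ i → length (groupG k m r Δ i) ≤ 6 * k * mᵢ m i
  length-groupG i = begin
    length (replicate (4 * k * M) _ ++ concatMap pairs (upTo k))
      ≡⟨ length-++ (replicate (4 * k * M) _) ⟩
    length (replicate (4 * k * M) _) + length (concatMap pairs (upTo k))
      ≤⟨ +-mono-≤ (≤-reflexive (length-replicate (4 * k * M)))
                  (length-concatMap-≤-* pairs (2 * M) length-pairs (upTo k)) ⟩
    4 * k * M + length (upTo k) * (2 * M)
      ≡⟨ cong (λ l → 4 * k * M + l * (2 * M)) (length-applyUpTo _ k) ⟩
    4 * k * M + k * (2 * M)
      ≡⟨ solve 2 (λ k M → con 4 :* k :* M :+ k :* (con 2 :* M) := con 6 :* k :* M) refl k M ⟩
    6 * k * M ∎
    where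
    open ≤-Reasoning
    M = mᵢ m i
    height : ℕ → ℚ
    height j = ℕ→ℚ (2 ^ j) ℚ.* rᵢ r i
    pairs : ℕ → List Point
    pairs j = replicate (multᵢⱼ m i j) (xᵢ r Δ i , height j)
           ++ replicate (multᵢⱼ m i j) (xᵢ r Δ i , ℚ.- height j)
    length-pairs : ∀ j → length (pairs j) ≤ 2 * M
    length-pairs j = begin
      length (pairs j)                                     ≡⟨ length-++ (replicate a _) ⟩
      length (replicate a (xᵢ r Δ i , height j))
        + length (replicate a (xᵢ r Δ i , ℚ.- height j))  ≡⟨ cong₂ _+_ (length-replicate a) (length-replicate a) ⟩
      a + a                                                ≤⟨ +-mono-≤ a≤M (m≤n⇒m≤n+o 0 a≤M) ⟩
      2 * M                                                ∎
      where
      a = multᵢⱼ m i j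
      a≤M : a ≤ M
      a≤M = multᵢⱼ≤mᵢ m i j

  offOriginGroups : ℕ → List Point
  offOriginGroups n = concatMap (groupG k m r Δ) (from1 n)

  3*length-offOriginGroups≤4*6km : ∀ n → 3 * length (offOriginGroups n) ≤ 4 * (6 * k * m)
  3*length-offOriginGroups≤4*6km n = begin
    3 * length (offOriginGroups n)
      ≤⟨ *-monoʳ-≤ 3 (length-concatMap-≤-sum (groupG k m r Δ) bound length-groupG (from1 n)) ⟩
    3 * sum (map bound (map suc (upTo n)))
      ≡⟨ cong (λ is → 3 * sum (map bound is)) (map-applyUpTo id suc n) ⟩
    3 * sum (map bound (applyUpTo suc n))
      ≡⟨ cong (λ bs → 3 * sum bs) (map-applyUpTo suc bound n) ⟩
    3 * sum (applyUpTo (bound ∘ suc) n)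
      ≤⟨ sum-applyUpTo-geometric 3 (bound ∘ suc) (*-div4^-decay (6 * k) m) n ⟩
    4 * (6 * k * m) ∎
    where
    open ≤-Reasoning
    bound : ℕ → ℕ
    bound i = 6 * k * mᵢ m i

  count-instanceX : count notOrigin (instanceX k m r Δ) ≡ count notOrigin (offOriginGroups (k ℕ.∸ 1))
  count-instanceX = begin
    count notOrigin (groupG₀ k m ++ R)                ≡⟨ count-++ notOrigin (groupG₀ k m) R ⟩
    count notOrigin (groupG₀ k m) + count notOrigin R ≡⟨ cong (_+ count notOrigin R) origin-free ⟩
    count notOrigin R                                 ∎
    where
    open ≡-Reasoning
    R = offOriginGroups (k ℕ.∸ 1)
    origin-free : count notOrigin (groupG₀ k m) ≡ 0
    origin-free = count-replicate-false notOrigin refl (12 * k * 2 ^ k * m)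

  count-notOrigin-instanceX-*2^k≤length : count notOrigin (instanceX k m r Δ) * 2 ^ k ≤ length (instanceX k m r Δ)
  count-notOrigin-instanceX-*2^k≤length = *-cancelˡ-≤ 3 (begin
    3 * (count notOrigin X * E)  ≡⟨ cong (λ c → 3 * (c * E)) count-instanceX ⟩
    3 * (count notOrigin R * E)  ≤⟨ *-monoʳ-≤ 3 (*-monoˡ-≤ E (count≤length notOrigin R)) ⟩
    3 * (length R * E)           ≡⟨ *-assoc 3 (length R) E ⟨
    3 * length R * E             ≤⟨ *-monoˡ-≤ E (3*length-offOriginGroups≤4*6km (k ℕ.∸ 1)) ⟩
    4 * (6 * k * m) * E          ≤⟨ m≤m+n _ (12 * k * m * E) ⟩
    4 * (6 * k * m) * E + 12 * k * m * E
      ≡⟨ solve 3 (λ k m E → con 4 :* (con 6 :* k :* m) :* E :+ con 12 :* k :* m :* E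
                          := con 3 :* (con 12 :* k :* E :* m)) refl k m E ⟩
    3 * (12 * k * E * m)         ≡⟨ cong (3 *_) (length-replicate (12 * k * E * m)) ⟨
    3 * length (groupG₀ k m)     ≤⟨ *-monoʳ-≤ 3 (m≤m+n (length (groupG₀ k m)) (length R)) ⟩
    3 * (length (groupG₀ k m) + length R) ≡⟨ cong (3 *_) (length-++ (groupG₀ k m)) ⟨
    3 * length X                 ∎)
    where
    open ≤-Reasoning
    X = instanceX k m r Δ
    R = offOriginGroups (k ℕ.∸ 1)
    E = 2 ^ k

lemma9 : (k m : ℕ) → 2 ≤ k → 1 ≤ m → MultiplicitiesIntegral k m →
         (r Δ : ℚ) → 0ℚ < r → 0ℚ < Δ →
         firstCenterProb notOrigin (instanceX k m r Δ) ℚ.≤ twoPowNeg k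
lemma9 k m _ _ _ r Δ _ _ =
  firstCenterProb-≤-1/ notOrigin (instanceX k m r Δ) (2 ^ k) {{m^n≢0 2 k}}
    (count-notOrigin-instanceX-*2^k≤length k m r Δ)
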